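{- Let $F\colon\mathbf{Set}\to\mathbf{Set}$ be a functor preserving weak pullbacks that has a separating set of monotone predicate liftings, and assume $F$ is separable by singletons. Let $\alpha\colon X\to FX$ be a coalgebra with $X$ finite. Then $\nu\mathcal F_\alpha=W_\alpha$, i.e. the greatest fixpoint of $\mathcal F_\alpha$ consists exactly of the pairs $(x_0,x_1)\in X\times X$ from which the duplicator has a winning strategy in the bisimulation game.
   Context: For a set $Y$ with a preorder $\le$, the lifted preorder $\le^F$ on $FY$ is: $t_0\le^F t_1$ iff there is $t\in F(\le)$ with $F\pi_i(t)=t_i$ ($i=0,1$), $\pi_i\colon{\le}\to Y$ the projections. We use $2=\{0,1\}$ with $0\le1$. An evaluation map $\lambda\colon F2\to2$ induces the predicate lifting $p\mapsto\lambda\circ Fp$; it is monotone if $\lambda$ is monotone w.r.t. $\le^F$. A set $\Lambda$ of evaluation maps is separating if for every set $X$ and $t_0\ne t_1\in FX$ there are $\lambda\in\Lambda$, $p\colon X\to2$ with $\lambda(Fp(t_0))\ne\lambda(Fp(t_1))$. $F$ is separable by singletons if for every set $X$ and all $t_0\neq t_1$ in $FX$ there is $p\colon X\to 2$ with $p(x)=1$ for exactly one $x\in X$ and $Fp(t_0)\ne Fp(t_1)$. $\chi_P$ denotes the characteristic function of $P\subseteq X$; $\mathit{Eq}(X)$ is the set of equivalence relations on $X$, and $E(R)$ the set of classes of $R$. $\mathcal F_\alpha\colon\mathit{Eq}(X)\to\mathit{Eq}(X)$, $\mathcal F_\alpha(R)=\{(x_0,x_1)\in R\mid \forall P\in E(R)\colon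 F\chi_P(\alpha(x_0))=F\chi_P(\alpha(x_1))\}$, and $\nu\mathcal F_\alpha$ is its greatest fixpoint. Bisimulation game from position $(x_0,x_1)$: Step 1: spoiler $S$ chooses $j\in\{0,1\}$ and $p_j\colon X\to2$. Step 2: duplicator $D$ must respond with $p_{1-j}\colon X\to2$ with $Fp_j(\alpha(x_j))\le^F Fp_{1-j}(\alpha(x_{1-j}))$. Step 3: $S$ chooses $\ell\in\{0,1\}$ and $x'_\ell$ with $p_\ell(x'_\ell)=1$. Step 4: $D$ must respond with $x'_{1-\ell}$ with $p_{1-\ell}(x'_{1-\ell})=1$. Play continues from $(x'_0,x'_1)$. $D$ wins if the play is infinite or $S$ has no move in Step 3; $S$ wins if $D$ has no move in Step 2 or 4. $W_\alpha$ is the set of pairs $(x_0,x_1)$ from which $D$ has a winning strategy. -}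

module Defs where

open import Data.Bool using (Bool; true; false; not; _≤_)
open import Data.Product using (Σ; _×_; _,_; proj₁; proj₂)
open import Relation.Binary.PropositionalEquality using (_≡_; _≢_)
open import Relation.Binary using (IsEquivalence)
open import Data.List using (List; []; _∷_)

record Functor : Set₁ where
  field
    F      : Set → Set
    fmap   : {A B : Set} → (A → B) → F A → F B
    fmap-id : {A : Set} (t : F A) → fmap (λ a → a) t ≡ t
    fmap-∘  : {A B C : Set} (f : A → B) (g : B → C) (t : F A) →
              fmap (λ a → g (f a)) t ≡ fmap g (fmap f t)

module _ (Fu : Functor) where
  open Functor Fu

  IsWeakPullback : {A B C W : Set} (f : A → C) (g : B → C)
                   (p₁ : W → A) (p₂ : W → B) → Set₁
  IsWeakPullback {A} {B} {C} {W} f g p₁ p₂ =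
    (∀ w → f (p₁ w) ≡ g (p₂ w)) ×
    ((Q : Set) (q₁ : Q → A) (q₂ : Q → B) → (∀ x → f (q₁ x) ≡ g (q₂ x)) →
       Σ (Q → W) λ h → (∀ x → p₁ (h x) ≡ q₁ x) × (∀ x → p₂ (h x) ≡ q₂ x))

  PreservesWeakPullbacks : Set₁
  PreservesWeakPullbacks =
    {A B C W : Set} (f : A → C) (g : B → C) (p₁ : W → A) (p₂ : W → B) →
    IsWeakPullback f g p₁ p₂ → IsWeakPullback (fmap f) (fmap g) (fmap p₁) (fmap p₂)

  Graph : {Y : Set} → (Y → Y → Set) → Set
  Graph {Y} _≼_ = Σ Y λ a → Σ Y λ b → a ≼ b

  π₀ : {Y : Set} {_≼_ : Y → Y → Set} → Graph _≼_ → Y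
  π₀ (a , _ , _) = a

  π₁ : {Y : Set} {_≼_ : Y → Y → Set} → Graph _≼_ → Y
  π₁ (_ , b , _) = b

  LiftedLeq : {Y : Set} (_≼_ : Y → Y → Set) → F Y → F Y → Set
  LiftedLeq _≼_ t₀ t₁ =
    Σ (F (Graph _≼_)) λ t → (fmap π₀ t ≡ t₀) × (fmap π₁ t ≡ t₁)

  _≤F_ : F Bool → F Bool → Set
  _≤F_ = LiftedLeq _≤_

  -- Evaluation maps λ : F2 → 2 (inducing predicate liftings p ↦ λ ∘ Fp).
  EvalMap : Set
  EvalMap = F Bool → Bool

  Monotone : EvalMap → Set
  Monotone ev = ∀ t₀ t₁ → t₀ ≤F t₁ → ev t₀ ≤ ev t₁

  Separating : {I : Set} → (I → EvalMap) → Set₁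
  Separating {I} Λ = (X : Set) (t₀ t₁ : F X) → t₀ ≢ t₁ →
    Σ I λ i → Σ (X → Bool) λ p → Λ i (fmap p t₀) ≢ Λ i (fmap p t₁)

  HasSeparatingMonotoneLiftings : Set₁
  HasSeparatingMonotoneLiftings =
    Σ Set λ I → Σ (I → EvalMap) λ Λ → (∀ i → Monotone (Λ i)) × Separating Λ

  IsSingleton : {X : Set} → (X → Bool) → Set
  IsSingleton {X} p = Σ X λ x → (p x ≡ true) × (∀ y → p y ≡ true → y ≡ x)

  SeparableBySingletons : Set₁
  SeparableBySingletons = (X : Set) (t₀ t₁ : F X) → t₀ ≢ t₁ →
    Σ (X → Bool) λ p → IsSingleton p × (fmap p t₀ ≢ fmap p t₁)

  module _ {X : Set} (α : X → F X) where

    -- P is an equivalence class of R, P given by its characteristic map χ_P.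
    IsClass : (X → X → Set) → (X → Bool) → Set
    IsClass R χ = Σ X λ x → ∀ y → ((χ y ≡ true → R x y) × (R x y → χ y ≡ true))

    𝓕 : (X → X → Set) → (X → X → Set)
    𝓕 R x₀ x₁ = R x₀ x₁ ×
      ((χ : X → Bool) → IsClass R χ → fmap χ (α x₀) ≡ fmap χ (α x₁))

    IsFixpoint : (X → X → Set) → Set
    IsFixpoint R = ∀ x₀ x₁ → (𝓕 R x₀ x₁ → R x₀ x₁) × (R x₀ x₁ → 𝓕 R x₀ x₁)

    IsGreatestFixpoint : (X → X → Set) → Set₁
    IsGreatestFixpoint R =
      IsEquivalence R × IsFixpoint R ×
      ((S : X → X → Set) → IsEquivalence S → IsFixpoint S →
         ∀ x₀ x₁ → S x₀ x₁ → R x₀ x₁)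

    -- assign j a b : the index-j component is a, the index-(1-j) one is b.
    assign : {A : Set} → Bool → A → A → Bool → A
    assign false a b false = a
    assign false a b true  = b
    assign true  a b false = b
    assign true  a b true  = a

    -- The bisimulation game.  Positions are pairs (a , b) = (x₀ , x₁).
    -- The spoiler's choices in one round: j, p_j (Step 1), ℓ, x′_ℓ (Step 3).
    record SMoves : Set where
      constructor smoves
      field
        j  : Bool
        pⱼ : X → Bool
        ℓ  : Bool
        x′ : X

    -- Histories: list of the spoiler's moves in completed rounds (newest
    -- first); the duplicator's moves are determined by her strategy.
    History : Set
    History = List SMoves

    record DStrategy : Set where
      field
        -- Step 2: p_{1-j} as a function of the history and of (j , p_j).
        step2 : History → (j : Bool) → (X → Bool) → (X → Bool)
        -- Step 4: x′_{1-ℓ} as a function of the history and all moves so far.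
        step4 : History → (j : Bool) → (pⱼ : X → Bool) → (ℓ : Bool) → X → X
    open DStrategy public

    -- Reach σ s₀ s₁ h a b : playing σ from (s₀ , s₁), the history h is
    -- possible (the spoiler's Step-3 choices were legal) and leads to (a , b).
    data Reach (σ : DStrategy) (s₀ s₁ : X) : History → X → X → Set where
      start : Reach σ s₀ s₁ [] s₀ s₁
      step  : ∀ {h a b} → Reach σ s₀ s₁ h a b →
              (j : Bool) (pⱼ : X → Bool) (ℓ : Bool) (x′ : X) →
              assign j pⱼ (step2 σ h j pⱼ) ℓ x′ ≡ true →
              Reach σ s₀ s₁ (smoves j pⱼ ℓ x′ ∷ h)
                (assign ℓ x′ (step4 σ h j pⱼ ℓ x′) false)
                (assign ℓ x′ (step4 σ h j pⱼ ℓ x′) true)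

    -- σ is winning from (s₀ , s₁): in every reachable position the moves
    -- prescribed by σ are legal, i.e. D is never stuck in Step 2 or Step 4
    -- (so every play is infinite or ends with S having no move in Step 3).
    Winning : DStrategy → X → X → Set
    Winning σ s₀ s₁ = ∀ h a b → Reach σ s₀ s₁ h a b →
      (j : Bool) (pⱼ : X → Bool) →
        (fmap pⱼ (α (assign false a b j)) ≤F fmap (step2 σ h j pⱼ) (α (assign false a b (not j)))) ×
        ((ℓ : Bool) (x′ : X) → assign j pⱼ (step2 σ h j pⱼ) ℓ x′ ≡ true →
           assign j pⱼ (step2 σ h j pⱼ) (not ℓ) (step4 σ h j pⱼ ℓ x′) ≡ true)

    W : X → X → Set
    W s₀ s₁ = Σ DStrategy λ σ → Winning σ s₀ s₁

module Submission where

-- The proof runs through the approximants R₀ = X × X, R_{k+1} = 𝓕_α(R_k).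
--  * Soundness (separating monotone liftings): all positions reachable under a
--    winning strategy lie in every R_k.  Were an R_k-class χ separated at such a
--    position, some lifting λ ∘ F(p ∘ χ) would tell the two sides apart, and by
--    monotonicity of λ the spoiler could play p ∘ χ and win.
--  * Completeness (separability by singletons): every equivalence S with
--    S ⊆ 𝓕_α(S) is contained in W_α.  The duplicator answers a predicate by its
--    S-saturation and so keeps the play inside S; singleton separability shows
--    that S-related states have equal α-successors in the quotient X/S.
--  * Finiteness: the descending chain R_k becomes stationary at some K, so R_K
--    is a post-fixed equivalence with W_α = R_K, which yields the theorem.
-- Excluded middle decides the relations involved (characteristic maps,
-- representatives, counting).

open import Defs
open import Data.Nat using (ℕ)
open import Data.Fin using (Fin)
open import Function.Bundles using (_↔_)
open import Axiom.ExcludedMiddle using (ExcludedMiddle)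
open import Level using (0ℓ)

open import Data.Nat using (zero; suc; _+_; _<_; z≤n; s≤s; s≤s⁻¹) renaming (_≤_ to _≤ℕ_)
open import Data.Nat.Properties using (≤-refl; +-mono-≤; +-mono-≤-<; <-≤-trans; n≮0)
open import Data.Bool using (Bool; true; false; not; T; if_then_else_; b≤b; f≤t; _≤_)
open import Data.Bool.Properties
  using (≤-trans; ≤-minimum; ≤-reflexive; ≤-antisym; T-≡; T-irrelevant)
open import Data.Product using (Σ; _×_; _,_; proj₁; proj₂)
open import Data.Sum using (_⊎_; inj₁; inj₂)
open import Data.Unit using (⊤; tt)
open import Data.Empty using (⊥; ⊥-elim)
open import Data.List using (List; []; _∷_; map; allFin; cartesianProduct)
open import Data.List.Membership.Propositional using (_∈_)
open import Data.List.Membership.Propositional.Properties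
  using (∈-map⁺; ∈-allFin; ∈-cartesianProduct⁺)
open import Data.List.Relation.Unary.Any using (here; there)
open import Function.Bundles using (Inverse; Equivalence)
open import Relation.Nullary using (yes; no; ¬_; does)
open import Relation.Nullary.Decidable using (dec-true; dec-false; decidable-stable)
open import Relation.Binary using (IsEquivalence; _⇒_; Symmetric)
open import Relation.Binary.PropositionalEquality
  using (_≡_; _≢_; refl; sym; trans; cong; subst; subst₂; module ≡-Reasoning)

-- A Boolean predicate p below q pointwise is below q in the lifted order,
-- witnessed by F applied to the map y ↦ (p y , q y) into the graph of ≤.
≤F-pointwise : (Fu : Functor) {X : Set} (p q : X → Bool) → (∀ y → p y ≤ q y) →
               (t : Functor.F Fu X) →
               _≤F_ Fu (Functor.fmap Fu p t) (Functor.fmap Fu q t)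
≤F-pointwise Fu {X} p q p≤q t =
  fmap pair t , sym (fmap-∘ pair (π₀ Fu) t) , sym (fmap-∘ pair (π₁ Fu) t)
  where
    open Functor Fu
    pair : X → Graph Fu _≤_
    pair y = p y , q y , p≤q y

≤-by-truth : ∀ {b c} → (b ≡ true → c ≡ true) → b ≤ c
≤-by-truth {false} _       = ≤-minimum _
≤-by-truth {true}  b⇒c   = ≤-reflexive (sym (b⇒c refl))

true≰false : ¬ (true ≤ false)
true≰false ()

≡-by-truth : ∀ {b c} → (b ≡ true → c ≡ true) → (c ≡ true → b ≡ true) → b ≡ c
≡-by-truth b⇒c c⇒b = ≤-antisym (≤-by-truth b⇒c) (≤-by-truth c⇒b)

differs-somewhere : (v : Bool → Bool) → v false ≢ v true →
                    Σ Bool λ j → v j ≡ true × v (not j) ≡ false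
differs-somewhere v differ with v false in v₀ | v true in v₁
... | true  | false = false , v₀ , v₁
... | false | true  = true , v₁ , v₀
... | true  | true  = ⊥-elim (differ refl)
... | false | false = ⊥-elim (differ refl)

enumeration : {X : Set} {n : ℕ} → X ↔ Fin n → Σ (List X) λ xs → ∀ x → x ∈ xs
enumeration {n = n} X↔Fin =
  map from (allFin n) , λ x →
    subst (_∈ map from (allFin n)) (strictlyInverseʳ x) (∈-map⁺ from (∈-allFin (to x)))
  where open Inverse X↔Fin using (to; from; strictlyInverseʳ)

descent : (Q : ℕ → Set) (f : ℕ → ℕ) → (∀ k → Q k ⊎ f (suc k) < f k) → Σ ℕ Q
descent Q f progress = search (f 0) 0 ≤-refl
  where
    search : (fuel k : ℕ) → f k ≤ℕ fuel → Σ ℕ Q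
    search fuel k fk≤fuel with progress k
    ... | inj₁ q = k , q
    search zero       k fk≤0      | inj₂ lt = ⊥-elim (n≮0 (<-≤-trans lt fk≤0))
    search (suc fuel) k fk≤1+fuel | inj₂ lt =
      search fuel (suc k) (s≤s⁻¹ (<-≤-trans lt fk≤1+fuel))

module Classical (em : ExcludedMiddle 0ℓ) where

  ⌊_⌋ : Set → Bool
  ⌊ P ⌋ = does (em {P})

  ⌊⌋-true : {P : Set} → P → ⌊ P ⌋ ≡ true
  ⌊⌋-true = dec-true em

  ⌊⌋-false : {P : Set} → ¬ P → ⌊ P ⌋ ≡ false
  ⌊⌋-false = dec-false em

  ⌊⌋-sound : {P : Set} → ⌊ P ⌋ ≡ true → P
  ⌊⌋-sound {P} with em {P}
  ... | yes p = λ _ → p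

  ⌊⌋-mono : {P Q : Set} → (P → Q) → ⌊ P ⌋ ≤ ⌊ Q ⌋
  ⌊⌋-mono P⇒Q = ≤-by-truth λ P-true → ⌊⌋-true (P⇒Q (⌊⌋-sound P-true))

  ⌊⌋-cong : {P Q : Set} → (P → Q) → (Q → P) → ⌊ P ⌋ ≡ ⌊ Q ⌋
  ⌊⌋-cong P⇒Q Q⇒P = ≤-antisym (⌊⌋-mono P⇒Q) (⌊⌋-mono Q⇒P)

  by-contradiction : {P : Set} → ¬ ¬ P → P
  by-contradiction = decidable-stable em

  choose : {A : Set} (P : A → Set) → A → A
  choose {A} P d with em {Σ A P}
  ... | yes (a , _) = a
  ... | no _        = d

  choose-spec : {A : Set} (P : A → Set) (d : A) → Σ A P → P (choose P d)
  choose-spec {A} P d ∃P with em {Σ A P}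
  ... | yes (_ , pa) = pa
  ... | no ¬∃P       = ⊥-elim (¬∃P ∃P)

module Finite (em : ExcludedMiddle 0ℓ) {A : Set} (enum : List A)
              (enumerates : ∀ a → a ∈ enum) where
  open Classical em

  first : (A → Bool) → A → List A → A
  first f d []       = d
  first f d (y ∷ ys) = if f y then y else first f d ys

  first-satisfies : ∀ f d ys → f (first f d ys) ≡ true ⊎ first f d ys ≡ d
  first-satisfies f d []       = inj₂ refl
  first-satisfies f d (y ∷ ys) with f y in fy
  ... | true  = inj₁ fy
  ... | false = first-satisfies f d ys

  first-cong : ∀ f g → (∀ y → f y ≡ g y) → ∀ d ys → first f d ys ≡ first g d ys
  first-cong f g f≗g d []       = refl
  first-cong f g f≗g d (y ∷ ys) rewrite f≗g y =
    cong (if g y then y else_) (first-cong f g f≗g d ys)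

  first-default : ∀ f d d′ ys {y} → y ∈ ys → f y ≡ true → first f d ys ≡ first f d′ ys
  first-default f d d′ (y ∷ ys) (here refl) fy rewrite fy = refl
  first-default f d d′ (z ∷ ys) (there y∈ys) fy with f z
  ... | true  = refl
  ... | false = first-default f d d′ ys y∈ys fy

  -- The quotient of A by an equivalence S, realised as the set of canonical
  -- representatives (the first S-related element of the listing).
  module Quotient {S : A → A → Set} (S-equiv : IsEquivalence S) where
    open IsEquivalence S-equiv renaming (refl to S-refl; sym to S-sym; trans to S-trans)

    rep : A → A
    rep x = first (λ y → ⌊ S x y ⌋) x enum

    rep-related : ∀ x → S x (rep x)
    rep-related x with first-satisfies (λ y → ⌊ S x y ⌋) x enum
    ... | inj₁ related = ⌊⌋-sound related
    ... | inj₂ rep≡x   = subst (S x) (sym rep≡x) S-refl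

    rep-resp : ∀ {x y} → S x y → rep x ≡ rep y
    rep-resp {x} {y} x~y = begin
      first (λ z → ⌊ S x z ⌋) x enum
        ≡⟨ first-cong _ _ (λ z → ⌊⌋-cong (S-trans (S-sym x~y)) (S-trans x~y)) x enum ⟩
      first (λ z → ⌊ S y z ⌋) x enum
        ≡⟨ first-default _ x y enum (enumerates y) (⌊⌋-true S-refl) ⟩
      first (λ z → ⌊ S y z ⌋) y enum ∎
      where open ≡-Reasoning

    -- Membership in Q is a proof of T b, which is proof-irrelevant, so
    -- elements of Q are equal as soon as their underlying states are.
    Q : Set
    Q = Σ A λ x → T ⌊ rep x ≡ x ⌋

    elem : Q → A
    elem = proj₁

    [_] : A → Q
    [ x ] = rep x , Equivalence.from T-≡ (⌊⌋-true (sym (rep-resp (rep-related x))))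

    Q-≡ : ∀ {r r′ : Q} → elem r ≡ elem r′ → r ≡ r′
    Q-≡ {x , t} {.x , t′} refl = cong (x ,_) (T-irrelevant t t′)

    []-resp : ∀ {x y} → S x y → [ x ] ≡ [ y ]
    []-resp x~y = Q-≡ (rep-resp x~y)

    []-reflect : ∀ {x y} → [ x ] ≡ [ y ] → S x y
    []-reflect {x} {y} eq =
      S-trans (rep-related x) (subst (λ z → S z y) (sym (cong elem eq)) (S-sym (rep-related y)))

    []-elem : ∀ r → [ elem r ] ≡ r
    []-elem (x , t) = Q-≡ (⌊⌋-sound (Equivalence.to T-≡ t))

  indicator : Bool → ℕ
  indicator b = if b then 1 else 0

  indicator-mono : ∀ {b c} → b ≤ c → indicator b ≤ℕ indicator c
  indicator-mono b≤b = ≤-refl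
  indicator-mono f≤t = z≤n

  count : (A → Bool) → List A → ℕ
  count f []       = 0
  count f (y ∷ ys) = indicator (f y) + count f ys

  count-mono : ∀ f g → (∀ y → f y ≤ g y) → ∀ ys → count f ys ≤ℕ count g ys
  count-mono f g f≤g []       = z≤n
  count-mono f g f≤g (y ∷ ys) = +-mono-≤ (indicator-mono (f≤g y)) (count-mono f g f≤g ys)

  count-< : ∀ f g → (∀ y → f y ≤ g y) → ∀ {y} ys → y ∈ ys →
            f y ≡ false → g y ≡ true → count f ys < count g ys
  count-< f g f≤g (y ∷ ys) (here refl) fy gy rewrite fy | gy = s≤s (count-mono f g f≤g ys)
  count-< f g f≤g (z ∷ ys) (there y∈ys) fy gy =
    +-mono-≤-< (indicator-mono (f≤g z)) (count-< f g f≤g ys y∈ys fy gy)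

  -- A descending chain of predicates on A is eventually stationary, since
  -- the number of listed elements satisfying P k cannot drop forever.
  stabilises : (P : ℕ → A → Set) → (∀ k {a} → P (suc k) a → P k a) →
               Σ ℕ λ K → ∀ {a} → P K a → P (suc K) a
  stabilises P descending = descent Stationary size shrink
    where
      Stationary : ℕ → Set
      Stationary K = ∀ {a} → P K a → P (suc K) a

      size : ℕ → ℕ
      size k = count (λ a → ⌊ P k a ⌋) enum

      shrink : ∀ k → Stationary k ⊎ size (suc k) < size k
      shrink k with em {Σ A λ a → P k a × ¬ P (suc k) a}
      ... | yes (a , in-k , out-suc-k) =
        inj₂ (count-< _ _ (λ _ → ⌊⌋-mono (descending k)) enum (enumerates a)
                      (⌊⌋-false out-suc-k) (⌊⌋-true in-k))
      ... | no none = inj₁ λ {a} in-k → by-contradiction λ out → none (a , in-k , out)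

module Game (em : ExcludedMiddle 0ℓ) (Fu : Functor) {X : Set} (α : X → Functor.F Fu X) where
  open Functor Fu
  open Classical em

  Rel : Set₁
  Rel = X → X → Set

  class-saturated : {R : Rel} → IsEquivalence R → ∀ {χ} → IsClass Fu α R χ →
                    ∀ {y y′} → R y y′ → χ y ≡ χ y′
  class-saturated R-equiv (c , member) {y} {y′} y~y′ =
    ≡-by-truth (λ χy → proj₂ (member y′) (R.trans (proj₁ (member y) χy) y~y′))
               (λ χy′ → proj₂ (member y) (R.trans (proj₁ (member y′) χy′) (R.sym y~y′)))
    where module R = IsEquivalence R-equiv

  class-transfer : {R R′ : Rel} → R ⇒ R′ → R′ ⇒ R →
                   ∀ {χ} → IsClass Fu α R χ → IsClass Fu α R′ χ
  class-transfer R⇒R′ R′⇒R (c , member) =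
    c , λ y → (λ χy → R⇒R′ (proj₁ (member y) χy)) , (λ c~y → proj₂ (member y) (R′⇒R c~y))

  𝓕-equivalence : {R : Rel} → IsEquivalence R → IsEquivalence (𝓕 Fu α R)
  𝓕-equivalence R-equiv = record
    { refl  = R.refl , λ _ _ → refl
    ; sym   = λ (r , same) → R.sym r , λ χ χ-class → sym (same χ χ-class)
    ; trans = λ (r , same) (r′ , same′) →
                R.trans r r′ , λ χ χ-class → trans (same χ χ-class) (same′ χ χ-class)
    }
    where module R = IsEquivalence R-equiv

  approx : ℕ → Rel
  approx zero    _ _ = ⊤
  approx (suc k)     = 𝓕 Fu α (approx k)

  approx-equivalence : ∀ k → IsEquivalence (approx k)
  approx-equivalence zero    = record { refl = tt ; sym = λ _ → tt ; trans = λ _ _ → tt }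
  approx-equivalence (suc k) = 𝓕-equivalence (approx-equivalence k)

  approx-descending : ∀ k → approx (suc k) ⇒ approx k
  approx-descending k = proj₁

  -- side a b j is the state of player j's side at the position (a , b).
  side : X → X → Bool → X
  side a b j = assign Fu α false a b j

  side-related : {R : Rel} → Symmetric R → ∀ {a b} → R a b →
                 ∀ j → R (side a b j) (side a b (not j))
  side-related R-sym a~b false = a~b
  side-related R-sym a~b true  = R-sym a~b

  -- After Step 4 the new position is (y , z) or (z , y), where the spoiler
  -- picked y on side ℓ and the duplicator z; for symmetric R it is R-related
  -- exactly when y and z are.
  next-related : {R : Rel} → Symmetric R → ∀ ℓ {y z} → R y z →
                 R (assign Fu α ℓ y z false) (assign Fu α ℓ y z true)
  next-related R-sym false y~z = y~z
  next-related R-sym true  y~z = R-sym y~z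

  next-related⁻ : {R : Rel} → Symmetric R → ∀ ℓ {y z} →
                  R (assign Fu α ℓ y z false) (assign Fu α ℓ y z true) → R y z
  next-related⁻ R-sym false y~z = y~z
  next-related⁻ R-sym true  z~y = R-sym z~y

  -- In Step 2 the spoiler's predicate sits at index j, the duplicator's at ¬j.
  assign-other : {A : Set} (j : Bool) (a b : A) → assign Fu α j a b (not j) ≡ b
  assign-other false a b = refl
  assign-other true  a b = refl

  assign-same : {A : Set} (j : Bool) (a b : A) → assign Fu α j a b (not (not j)) ≡ a
  assign-same false a b = refl
  assign-same true  a b = refl

  module Soundness {I : Set} (Λ : I → EvalMap Fu) (Λ-monotone : ∀ i → Monotone Fu (Λ i))
                   (Λ-separating : Separating Fu Λ) where

    -- The spoiler attacks a reachable position (a , b) by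
    -- playing an R-respecting predicate P on side j; σ must answer inside P,
    -- so no lifting Λ i can separate F P at the two sides.
    module Play (σ : DStrategy Fu α) {s₀ s₁ : X} (σ-wins : Winning Fu α σ s₀ s₁)
                {R : Rel} (R-equiv : IsEquivalence R)
                (reachable⇒R : ∀ {h a b} → Reach Fu α σ s₀ s₁ h a b → R a b) where

      R-sym : Symmetric R
      R-sym = IsEquivalence.sym R-equiv

      -- The answer q of σ lies inside P: if q y holds, the spoiler may pick y
      -- on side ¬j; the reply z satisfies P, and the new position, being
      -- reachable, relates y and z, so P y = P z = true.
      answer-inside : ∀ {h a b} → Reach Fu α σ s₀ s₁ h a b →
                      ∀ P → (∀ {y y′} → R y y′ → P y ≡ P y′) →
                      ∀ j y → step2 σ h j P y ≡ true → P y ≡ true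
      answer-inside {h} {a} {b} r P P-resp j y qy = trans (P-resp y~z) Pz
        where
          q : X → Bool
          q = step2 σ h j P
          legal : assign Fu α j P q (not j) y ≡ true
          legal = trans (cong (λ f → f y) (assign-other j P q)) qy
          z : X
          z = step4 σ h j P (not j) y
          Pz : P z ≡ true
          Pz = trans (cong (λ f → f z) (sym (assign-same j P q)))
                     (proj₂ (σ-wins h a b r j P) (not j) y legal)
          y~z : R y z
          y~z = next-related⁻ {R = R} R-sym (not j)
                  (reachable⇒R (step r j P (not j) y legal))

      -- Hence monotonicity of Λ i carries the value true from side j over to
      -- side ¬j: no lifting of an R-respecting predicate separates the sides.
      unseparated : ∀ {h a b} → Reach Fu α σ s₀ s₁ h a b →
                    ∀ i P → (∀ {y y′} → R y y′ → P y ≡ P y′) → ∀ j →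
                    Λ i (fmap P (α (side a b j))) ≡ true →
                    Λ i (fmap P (α (side a b (not j)))) ≡ false → ⊥
      unseparated {h} {a} {b} r i P P-resp j true-on-j false-on-¬j =
        true≰false (subst₂ _≤_ true-on-j false-on-¬j (≤-trans duplicator-move answer⊆P))
        where
          q : X → Bool
          q = step2 σ h j P
          duplicator-move : Λ i (fmap P (α (side a b j))) ≤ Λ i (fmap q (α (side a b (not j))))
          duplicator-move = Λ-monotone i _ _ (proj₁ (σ-wins h a b r j P))
          answer⊆P : Λ i (fmap q (α (side a b (not j)))) ≤ Λ i (fmap P (α (side a b (not j))))
          answer⊆P = Λ-monotone i _ _ (≤F-pointwise Fu q P
                       (λ y → ≤-by-truth (answer-inside r P P-resp j y)) (α (side a b (not j))))

      -- One refinement step: an R-class cannot separate the successors of a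
      -- reachable position, since composing it with a separating lifting gives
      -- an R-respecting predicate separated by some Λ i.
      reachable⇒𝓕 : ∀ {h a b} → Reach Fu α σ s₀ s₁ h a b → 𝓕 Fu α R a b
      reachable⇒𝓕 {h} {a} {b} r = reachable⇒R r , λ χ χ-class → by-contradiction λ differ →
        let i , p , separates = Λ-separating Bool _ _ differ
            P : X → Bool
            P y = p (χ y)
            value : Bool → Bool
            value j = Λ i (fmap P (α (side a b j)))
            lift : ∀ x → Λ i (fmap P (α x)) ≡ Λ i (fmap p (fmap χ (α x)))
            lift x = cong (Λ i) (fmap-∘ χ p (α x))
            j , true-on-j , false-on-¬j =
              differs-somewhere value λ same → separates (trans (sym (lift a)) (trans same (lift b)))
        in unseparated r i P (λ y~y′ → cong p (class-saturated R-equiv χ-class y~y′))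
                       j true-on-j false-on-¬j

    winning⇒approx : ∀ {σ s₀ s₁} → Winning Fu α σ s₀ s₁ →
                     ∀ k {h a b} → Reach Fu α σ s₀ s₁ h a b → approx k a b
    winning⇒approx σ-wins zero    r = tt
    winning⇒approx σ-wins (suc k) r =
      Play.reachable⇒𝓕 _ σ-wins (approx-equivalence k) (winning⇒approx σ-wins k) r

    W⇒approx : ∀ k → W Fu α ⇒ approx k
    W⇒approx k (σ , σ-wins) = winning⇒approx σ-wins k start

  module Completeness (separable : SeparableBySingletons Fu)
                      (enum : List X) (enumerates : ∀ x → x ∈ enum)
                      {S : Rel} (S-equiv : IsEquivalence S) (S-post : S ⇒ 𝓕 Fu α S) where
    open IsEquivalence S-equiv renaming (refl to S-refl; sym to S-sym; trans to S-trans)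
    open Finite em enum enumerates using (module Quotient)
    open Quotient S-equiv

    singleton-class : {p : Q → Bool} → IsSingleton Fu p → IsClass Fu α S (λ y → p [ y ])
    singleton-class {p} (r , pr , unique) = elem r , λ y →
      (λ py → S-sym ([]-reflect (trans (unique [ y ] py) (sym ([]-elem r))))) ,
      (λ r~y → subst (λ s → p s ≡ true) (sym (trans ([]-resp (S-sym r~y)) ([]-elem r))) pr)

    -- S-related states have the same successors in X/S: otherwise a singleton
    -- separates them, and its preimage is an S-class separating them.
    successors-agree : ∀ {x₀ x₁} → S x₀ x₁ → fmap [_] (α x₀) ≡ fmap [_] (α x₁)
    successors-agree {x₀} {x₁} x₀~x₁ = by-contradiction λ differ →
      let p , p-singleton , separates = separable Q _ _ differ
      in separates (begin
           fmap p (fmap [_] (α x₀))      ≡⟨ sym (fmap-∘ [_] p (α x₀)) ⟩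
           fmap (λ y → p [ y ]) (α x₀)
             ≡⟨ proj₂ (S-post x₀~x₁) _ (singleton-class p-singleton) ⟩
           fmap (λ y → p [ y ]) (α x₁)   ≡⟨ fmap-∘ [_] p (α x₁) ⟩
           fmap p (fmap [_] (α x₁))      ∎)
      where open ≡-Reasoning

    factored-agree : (g : Q → Bool) → ∀ {x₀ x₁} → S x₀ x₁ →
                     fmap (λ y → g [ y ]) (α x₀) ≡ fmap (λ y → g [ y ]) (α x₁)
    factored-agree g {x₀} {x₁} x₀~x₁ = begin
      fmap (λ y → g [ y ]) (α x₀)   ≡⟨ fmap-∘ [_] g (α x₀) ⟩
      fmap g (fmap [_] (α x₀))      ≡⟨ cong (fmap g) (successors-agree x₀~x₁) ⟩
      fmap g (fmap [_] (α x₁))      ≡⟨ sym (fmap-∘ [_] g (α x₁)) ⟩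
      fmap (λ y → g [ y ]) (α x₁)   ∎
      where open ≡-Reasoning

    meets : (X → Bool) → Q → Bool
    meets p r = ⌊ Σ X (λ x → p x ≡ true × S x (elem r)) ⌋

    saturate : (X → Bool) → X → Bool
    saturate p y = meets p [ y ]

    saturate-extends : ∀ p {y} → p y ≡ true → saturate p y ≡ true
    saturate-extends p {y} py = ⌊⌋-true (y , py , rep-related y)

    saturate-witness : ∀ p {y} → saturate p y ≡ true → Σ X λ x → p x ≡ true × S y x
    saturate-witness p {y} sat =
      let x , px , x~rep = ⌊⌋-sound sat in x , px , S-trans (rep-related y) (S-sym x~rep)

    -- The duplicator's strategy: answer p_j by its saturation; in Step 4
    -- answer a state S-related to the spoiler's, repeating it when it lies on
    -- the p_j side and choosing a partner inside p_j otherwise.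
    partner : (X → Bool) → X → X
    partner p x′ = choose (λ x → p x ≡ true × S x′ x) x′

    respond : (j ℓ : Bool) → (X → Bool) → X → X
    respond false false p x′ = x′
    respond true  true  p x′ = x′
    respond false true  p x′ = partner p x′
    respond true  false p x′ = partner p x′

    respond-legal : ∀ j ℓ p x′ → assign Fu α j p (saturate p) ℓ x′ ≡ true →
                    assign Fu α j p (saturate p) (not ℓ) (respond j ℓ p x′) ≡ true ×
                    S x′ (respond j ℓ p x′)
    respond-legal false false p x′ px′   = saturate-extends p px′ , S-refl
    respond-legal true  true  p x′ px′   = saturate-extends p px′ , S-refl
    respond-legal false true  p x′ satx′ = choose-spec _ x′ (saturate-witness p satx′)
    respond-legal true  false p x′ satx′ = choose-spec _ x′ (saturate-witness p satx′)

    strategy : DStrategy Fu α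
    strategy = record { step2 = λ _ _ p → saturate p
                      ; step4 = λ _ j p ℓ x′ → respond j ℓ p x′ }

    module _ {s₀ s₁ : X} (s₀~s₁ : S s₀ s₁) where

      reachable-related : ∀ {h a b} → Reach Fu α strategy s₀ s₁ h a b → S a b
      reachable-related start = s₀~s₁
      reachable-related (step _ j p ℓ x′ legal) =
        next-related {R = S} S-sym ℓ (proj₂ (respond-legal j ℓ p x′ legal))

      -- Step 2 is legal since p ≤ saturate p pointwise and saturate p
      -- factors through X/S; Step 4 is legal by respond-legal.
      strategy-wins : Winning Fu α strategy s₀ s₁
      strategy-wins h a b r j p =
        saturation-dominates , λ ℓ x′ legal → proj₁ (respond-legal j ℓ p x′ legal)
        where
          saturation-dominates : _≤F_ Fu (fmap p (α (side a b j)))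
                                         (fmap (saturate p) (α (side a b (not j))))
          saturation-dominates =
            subst (_≤F_ Fu (fmap p (α (side a b j))))
                  (factored-agree (meets p) (side-related {R = S} S-sym (reachable-related r) j))
                  (≤F-pointwise Fu p (saturate p) (λ _ → ≤-by-truth (saturate-extends p))
                                (α (side a b j)))

    post-fixed⇒W : S ⇒ W Fu α
    post-fixed⇒W s₀~s₁ = strategy , strategy-wins s₀~s₁

  greatest-fixpoint-from : {R B : Rel} → R ⇒ B → IsEquivalence B → B ⇒ 𝓕 Fu α B →
                           (∀ S → IsEquivalence S → S ⇒ 𝓕 Fu α S → S ⇒ R) →
                           IsGreatestFixpoint Fu α R
  greatest-fixpoint-from {R} {B} R⇒B B-equiv B-post contains-post =
    R-equiv , R-fixpoint ,
    λ S S-equiv S-fixpoint _ _ → contains-post S S-equiv (proj₂ (S-fixpoint _ _))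
    where
      module B = IsEquivalence B-equiv
      B⇒R : B ⇒ R
      B⇒R = contains-post B B-equiv B-post
      R-equiv : IsEquivalence R
      R-equiv = record
        { refl  = B⇒R B.refl
        ; sym   = λ r → B⇒R (B.sym (R⇒B r))
        ; trans = λ r r′ → B⇒R (B.trans (R⇒B r) (R⇒B r′))
        }
      R-fixpoint : IsFixpoint Fu α R
      R-fixpoint _ _ = proj₁ , λ r →
        r , λ χ χ-class → proj₂ (B-post (R⇒B r)) χ (class-transfer R⇒B B⇒R χ-class)

  -- The theorem for a coalgebra on a listed set X: the approximants become
  -- stationary at some K, R_K is a post-fixed equivalence containing W_α by
  -- soundness, and every post-fixed equivalence lies in W_α by completeness.
  W-greatest-fixpoint : HasSeparatingMonotoneLiftings Fu → SeparableBySingletons Fu →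
                        (enum : List X) → (∀ x → x ∈ enum) → IsGreatestFixpoint Fu α (W Fu α)
  W-greatest-fixpoint (_ , Λ , Λ-monotone , Λ-separating) separable enum enumerates =
    greatest-fixpoint-from (W⇒approx K) (approx-equivalence K) (proj₂ stationary-stage)
      λ S S-equiv S-post → Completeness.post-fixed⇒W separable enum enumerates S-equiv S-post
    where
      open Soundness Λ Λ-monotone Λ-separating

      pairs-enumerated : ∀ xy → xy ∈ cartesianProduct enum enum
      pairs-enumerated (x , y) = ∈-cartesianProduct⁺ (enumerates x) (enumerates y)
      open Finite em (cartesianProduct enum enum) pairs-enumerated using (stabilises)

      stationary-stage : Σ ℕ λ K → approx K ⇒ approx (suc K)
      stationary-stage =
        let K , stationary = stabilises (λ k xy → approx k (proj₁ xy) (proj₂ xy))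
                                        (λ k → approx-descending k)
        in K , λ {x} {y} → stationary {x , y}

      K : ℕ
      K = proj₁ stationary-stage

theorem2 : ExcludedMiddle 0ℓ → (Fu : Functor) →
    PreservesWeakPullbacks Fu → HasSeparatingMonotoneLiftings Fu →
    SeparableBySingletons Fu →
    (X : Set) (n : ℕ) → X ↔ Fin n → (α : X → Functor.F Fu X) →
    IsGreatestFixpoint Fu α (W Fu α)
theorem2 em Fu _ liftings separable X n X↔Fin α =
  Game.W-greatest-fixpoint em Fu α liftings separable (proj₁ listing) (proj₂ listing)
  where
    listing : Σ (List X) λ xs → ∀ x → x ∈ xs
    listing = enumeration X↔Fin
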